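{- Let $w\in\mathbb{YF}_\infty^+$, $\delta\in(0,1)$, $n\in\mathbb{N}_0$ with $n\ge1$, and $v\in P(w,n,\delta)$, where $P(w,n,\delta)=\{v\in\mathbb{YF}_n:\ h'(v,w)\ge(1-\delta)n\}$. Let $X$ be the word $2^{\lceil\delta n/2\rceil}1^{2\lceil(1-\delta)n/2\rceil-1}$. Then $$\prod_{i=1}^{\lceil\delta n/2\rceil}\frac{g(X,i)-1}{g(X,i)}\le\frac{\pi(v)}{\pi(w)}.$$
   Context: Words are finite words over $\{1,2\}$; $|x|$ is the digit sum and $d(x)$ the number of $2$'s of $x$; $2^k,1^k$ denote powers and juxtaposition is concatenation. $\mathbb{YF}$ is the set of all finite words, $\mathbb{YF}_n=\{x:|x|=n\}$. $\mathbb{YF}_\infty$ is the set of left-infinite words $\dots\alpha_2\alpha_1$ over $\{1,2\}$. For $x$ finite or left-infinite and $1\le i\le d(x)$, $g(x,i)=1+$ (digit sum of the part of $x$ strictly to the right of the $i$-th letter $2$ of $x$, counting from the right). $\pi(x)=\prod_{i:\,g(x,i)>1}\frac{g(x,i)-1}{g(x,i)}$; $\mathbb{YF}_\infty^+=\{w\in\mathbb{YF}_\infty:\pi(w)>0\}$. $h'(x,y)$ is the digit sum of the longest common suffix of $x$ and $y$.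
   Formalization: The parameter δ ranges over the rationals in $(0,1)$. -}

module Defs where

open import Data.Nat as ℕ using (ℕ; zero; suc; _∸_)
open import Data.Integer as ℤ using (ℤ; +_; ∣_∣)
open import Data.Rational using (ℚ; _/_; 1ℚ; _*_; _+_; _-_; _≤_; _<_; 0ℚ; ceiling)
open import Data.Product using (Σ; _×_)
open import Relation.Binary.PropositionalEquality using (_≡_)
open import Data.List using (List; []; _∷_; reverse; foldr; replicate; _++_)

data Digit : Set where
  one two : Digit

val : Digit → ℕ
val one = 1
val two = 2

-- A finite word is a list of digits in written order: the word α_k … α_1 is
-- the list [α_k , … , α_1]; concatenation is _++_, powers are replicate.
Word : Set
Word = List Digit

dsum : Word → ℕ
dsum = foldr (λ d s → val d ℕ.+ s) 0

-- A left-infinite word … α_2 α_1 is a function ℕ → Digit with  w 0 = α_1.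
InfWord : Set
InfWord = ℕ → Digit

suffix : ℕ → InfWord → Word
suffix zero    w = []
suffix (suc k) w = suffix k (λ j → w (suc j)) ++ (w 0 ∷ [])

-- Given the letters read from right to left (α_1 first) and the digit sum s
-- of what lies to the right, list the values g(x,1), g(x,2), … .
gFromRight : ℕ → List Digit → List ℕ
gFromRight s []          = []
gFromRight s (one ∷ r)   = gFromRight (s ℕ.+ 1) r
gFromRight s (two ∷ r)   = suc s ∷ gFromRight (s ℕ.+ 2) r

gList : Word → List ℕ
gList x = gFromRight 0 (reverse x)

nth : List ℕ → ℕ → ℕ
nth []       _       = 0
nth (a ∷ as) zero    = a
nth (a ∷ as) (suc i) = nth as i

g : Word → ℕ → ℕ
g x i = nth (gList x) (i ∸ 1)

-- (m-1)/m as a rational, for m ≥ 1 (m = 0 never occurs as a g-value)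
ratio : ℕ → ℚ
ratio zero    = 1ℚ
ratio (suc m) = + m / suc m

piFactor : ℕ → ℚ
piFactor zero          = 1ℚ
piFactor (suc zero)    = 1ℚ
piFactor (suc (suc m)) = ratio (suc (suc m))

piFin : Word → ℚ
piFin x = foldr (λ m q → piFactor m * q) 1ℚ (gList x)

-- π(w) for a left-infinite word is the limit (= infimum, the sequence being
-- non-increasing) of the partial products  piPartial w k = π(α_k … α_1).
piPartial : InfWord → ℕ → ℚ
piPartial w k = piFin (suffix k w)

-- w ∈ YF_∞⁺ :  π(w) > 0, i.e. the partial products are bounded below by a
-- positive rational.
InYFInfPlus : InfWord → Set
InYFInfPlus w = Σ ℚ (λ c → (0ℚ < c) × ((k : ℕ) → c ≤ piPartial w k))

hcsRev : List Digit → InfWord → ℕ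
hcsRev []        w = 0
hcsRev (one ∷ r) w with w 0
... | one = 1 ℕ.+ hcsRev r (λ j → w (suc j))
... | two = 0
hcsRev (two ∷ r) w with w 0
... | one = 0
... | two = 2 ℕ.+ hcsRev r (λ j → w (suc j))

h' : Word → InfWord → ℕ
h' v w = hcsRev (reverse v) w

prodFrom1 : ℕ → (ℕ → ℚ) → ℚ
prodFrom1 zero    f = 1ℚ
prodFrom1 (suc a) f = prodFrom1 a f * f (suc a)

fromℕ : ℕ → ℚ
fromℕ n = + n / 1

-- ⌈q⌉ as a natural number (used only for positive q)
ceilℕ : ℚ → ℕ
ceilℕ q = ∣ ceiling q ∣

InP : InfWord → ℕ → ℚ → Word → Set
InP w n δ v = (dsum v ≡ n) × ((1ℚ - δ) * fromℕ n ≤ fromℕ (h' v w))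

aX : ℕ → ℚ → ℕ
aX n δ = ceilℕ (δ * fromℕ n * (+ 1 / 2))

wordX : ℕ → ℚ → Word
wordX n δ = replicate (aX n δ) two
         ++ replicate (2 ℕ.* ceilℕ ((1ℚ - δ) * fromℕ n * (+ 1 / 2)) ∸ 1) one

-- Reading v from the right, it starts with the longest common suffix α_k … α_1
-- of v and w, of digit sum h = h'(v,w) ≥ (1-δ)n, followed by letters q of digit
-- sum n - h ≤ δn, so q contains at most ⌈δn/2⌉ letters 2.  The g-values only see
-- the digit sum to the right, hence π(v) = π(α_k … α_1) · Π_q, where the i-th
-- letter 2 of q contributes (m-1)/m with
-- m ≥ 1 + h + 2(i-1) ≥ 1 + b + 2(i-1) = g(X,i),  b = 2⌈(1-δ)n/2⌉ - 1 ≤ h.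
-- Since (m-1)/m increases with m and stays in [0,1], Π_q dominates the product
-- over X, and multiplying by π(α_k … α_1) gives the bound at the partial product k.

module Submission where

open import Defs
open import Data.Nat using (ℕ; _≥_)
open import Data.Rational using (ℚ; _<_; _≤_; _*_; _+_; 0ℚ; 1ℚ)
open import Data.Product using (Σ; _×_)

open import Data.Nat as ℕ using (zero; suc; z≤n; _∸_)
import Data.Nat.Properties as ℕP
open import Data.Nat.Coprimality as Cop using (Coprime)
open import Data.Integer as ℤ using (ℤ; +_; -[1+_]; 0ℤ; ∣_∣)
import Data.Integer.Properties as ℤP
open import Data.Integer.DivMod using (a≡a%n+[a/n]*n; n%d<d)
import Data.Integer.Solver
open import Data.Rational.Solver using (module +-*-Solver)
open import Data.Rational as ℚ using (mkℚ; _-_; *≤*; toℚᵘ)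
import Data.Rational.Properties as ℚP
open import Data.Rational.Unnormalised as ℚᵘ using (mkℚᵘ)
import Data.Rational.Unnormalised.Properties as ℚᵘP
open import Data.Product using (_,_; proj₁; proj₂)
open import Relation.Binary.PropositionalEquality hiding ([_])
open import Function using (_∘_)
open import Data.List using (List; []; _∷_; _++_; [_]; reverse; replicate; foldr; length; map)
import Data.List.Properties as ListP
open import Data.List.Relation.Binary.Permutation.Propositional.Properties using (↭-reverse; map⁺)
open import Data.Nat.ListAction using (sum)
open import Data.Nat.ListAction.Properties using (sum-↭)

-- For n ≥ 0 the integer -⌊-n/d⌋ is ⌈n/d⌉.
ceilDiv-bounds : ∀ n d → let k = ∣ ℤ.- ((ℤ.- + n) ℤ./ + suc d) ∣ in
                 n ℕ.≤ k ℕ.* suc d × k ℕ.* suc d ℕ.< n ℕ.+ suc d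
ceilDiv-bounds n d-1 = subst (n ℕ.≤_) (sym k*d≡n+r) (ℕP.m≤m+n n r)
                     , subst (ℕ._< n ℕ.+ d) (sym k*d≡n+r) (ℕP.+-monoʳ-< n (n%d<d (ℤ.- + n) (+ d)))
  where
  d = suc d-1
  q = (ℤ.- + n) ℤ./ + d
  r = (ℤ.- + n) ℤ.% + d
  open Data.Integer.Solver.+-*-Solver
  -q*d≡n+r : ℤ.- q ℤ.* + d ≡ + (n ℕ.+ r)
  -q*d≡n+r = begin
    ℤ.- q ℤ.* + d                  ≡⟨ sym (ℤP.neg-distribˡ-* q (+ d)) ⟩
    ℤ.- (q ℤ.* + d)                ≡⟨ solve 2 (λ x y → :- y := (:- (x :+ y)) :+ x) refl (+ r) (q ℤ.* + d) ⟩
    ℤ.- (+ r ℤ.+ q ℤ.* + d) ℤ.+ + r ≡⟨ cong (λ z → ℤ.- z ℤ.+ + r) (sym (a≡a%n+[a/n]*n (ℤ.- + n) (+ d))) ⟩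
    ℤ.- (ℤ.- + n) ℤ.+ + r          ≡⟨ cong (ℤ._+ + r) (ℤP.neg-involutive (+ n)) ⟩
    + n ℤ.+ + r                    ≡⟨ sym (ℤP.pos-+ n r) ⟩
    + (n ℕ.+ r)                    ∎
    where open ≡-Reasoning
  0≤-q : 0ℤ ℤ.≤ ℤ.- q
  0≤-q = ℤP.*-cancelʳ-≤-pos 0ℤ (ℤ.- q) (+ d) (subst (0ℤ ℤ.≤_) (sym -q*d≡n+r) (ℤ.+≤+ z≤n))
  k*d≡n+r : ∣ ℤ.- q ∣ ℕ.* d ≡ n ℕ.+ r
  k*d≡n+r = ℤP.+-injective (begin
    + (∣ ℤ.- q ∣ ℕ.* d)  ≡⟨ ℤP.pos-* ∣ ℤ.- q ∣ d ⟩
    + ∣ ℤ.- q ∣ ℤ.* + d  ≡⟨ cong (ℤ._* + d) (ℤP.0≤i⇒+∣i∣≡i 0≤-q) ⟩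
    ℤ.- q ℤ.* + d        ≡⟨ -q*d≡n+r ⟩
    + (n ℕ.+ r)          ∎)
    where open ≡-Reasoning

toℚᵘ-/ : ∀ n d → toℚᵘ (+ n ℚ./ suc d) ℚᵘ.≃ mkℚᵘ (+ n) d
toℚᵘ-/ n d = ℚP.toℚᵘ-fromℚᵘ (mkℚᵘ (+ n) d)

/-mono-≤ : ∀ {m n d e} → m ℕ.* suc e ℕ.≤ n ℕ.* suc d → + m ℚ./ suc d ≤ + n ℚ./ suc e
/-mono-≤ {m} {n} {d} {e} le = ℚP.toℚᵘ-cancel-≤ (begin
  toℚᵘ (+ m ℚ./ suc d) ≃⟨ toℚᵘ-/ m d ⟩
  mkℚᵘ (+ m) d         ≤⟨ ℚᵘ.*≤* (subst₂ ℤ._≤_ (ℤP.pos-* m (suc e)) (ℤP.pos-* n (suc d)) (ℤ.+≤+ le)) ⟩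
  mkℚᵘ (+ n) e         ≃⟨ ℚᵘP.≃-sym (toℚᵘ-/ n e) ⟩
  toℚᵘ (+ n ℚ./ suc e) ∎)
  where open ℚᵘP.≤-Reasoning

/-mono-< : ∀ {m n d e} → m ℕ.* suc e ℕ.< n ℕ.* suc d → + m ℚ./ suc d < + n ℚ./ suc e
/-mono-< {m} {n} {d} {e} lt = ℚP.toℚᵘ-cancel-< (begin-strict
  toℚᵘ (+ m ℚ./ suc d) ≃⟨ toℚᵘ-/ m d ⟩
  mkℚᵘ (+ m) d         <⟨ ℚᵘ.*<* (subst₂ ℤ._<_ (ℤP.pos-* m (suc e)) (ℤP.pos-* n (suc d)) (ℤ.+<+ lt)) ⟩
  mkℚᵘ (+ n) e         ≃⟨ ℚᵘP.≃-sym (toℚᵘ-/ n e) ⟩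
  toℚᵘ (+ n ℚ./ suc e) ∎)
  where open ℚᵘP.≤-Reasoning

/-cancel-≤ : ∀ {m n d e} → + m ℚ./ suc d ≤ + n ℚ./ suc e → m ℕ.* suc e ℕ.≤ n ℕ.* suc d
/-cancel-≤ {m} {n} {d} {e} le with ℚᵘP.≤-respʳ-≃ (toℚᵘ-/ n e) (ℚᵘP.≤-respˡ-≃ (toℚᵘ-/ m d) (ℚP.toℚᵘ-mono-≤ le))
... | ℚᵘ.*≤* le′ = ℤP.drop‿+≤+ (subst₂ ℤ._≤_ (sym (ℤP.pos-* m (suc e))) (sym (ℤP.pos-* n (suc d))) le′)

/-cancel-< : ∀ {m n d e} → + m ℚ./ suc d < + n ℚ./ suc e → m ℕ.* suc e ℕ.< n ℕ.* suc d
/-cancel-< {m} {n} {d} {e} lt with ℚᵘP.<-respʳ-≃ (toℚᵘ-/ n e) (ℚᵘP.<-respˡ-≃ (toℚᵘ-/ m d) (ℚP.toℚᵘ-mono-< lt))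
... | ℚᵘ.*<* lt′ = ℤP.drop‿+<+ (subst₂ ℤ._<_ (sym (ℤP.pos-* m (suc e))) (sym (ℤP.pos-* n (suc d))) lt′)

0≤1 : 0ℚ ≤ 1ℚ
0≤1 = /-mono-≤ {0} {1} {0} {0} z≤n

*-nonNeg : ∀ {p q} → 0ℚ ≤ p → 0ℚ ≤ q → 0ℚ ≤ p * q
*-nonNeg {p} {q} 0≤p 0≤q =
  ℚP.nonNegative⁻¹ (p * q) {{ℚP.nonNeg*nonNeg⇒nonNeg p {{ℚ.nonNegative 0≤p}} q {{ℚ.nonNegative 0≤q}}}}

p≤q⇒0≤q-p : ∀ {p q} → p ≤ q → 0ℚ ≤ q - p
p≤q⇒0≤q-p {p} {q} p≤q = subst (_≤ q - p) (ℚP.+-inverseʳ p) (ℚP.+-monoˡ-≤ (ℚ.- p) p≤q)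

*-mono-≤-nonNeg : ∀ {p q r s} → 0ℚ ≤ p → 0ℚ ≤ r → p ≤ q → r ≤ s → p * r ≤ q * s
*-mono-≤-nonNeg {p} {q} {r} {s} 0≤p 0≤r p≤q r≤s = begin
  p * r ≤⟨ ℚP.*-monoʳ-≤-nonNeg r {{ℚ.nonNegative 0≤r}} p≤q ⟩
  q * r ≤⟨ ℚP.*-monoˡ-≤-nonNeg q {{ℚ.nonNegative (ℚP.≤-trans 0≤p p≤q)}} r≤s ⟩
  q * s ∎
  where open ℚP.≤-Reasoning

fromℕ≡mkℚ : ∀ n → fromℕ n ≡ mkℚ (+ n) 0 (Cop.sym (Cop.1-coprimeTo n))
fromℕ≡mkℚ n = ℚP.↥p/↧p≡p _

fromℕ-mono-≤ : ∀ {m n} → m ℕ.≤ n → fromℕ m ≤ fromℕ n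
fromℕ-mono-≤ {m} {n} le = /-mono-≤ {m} {n} {0} {0} (subst₂ ℕ._≤_ (sym (ℕP.*-identityʳ m)) (sym (ℕP.*-identityʳ n)) le)

fromℕ-cancel-≤ : ∀ {m n} → fromℕ m ≤ fromℕ n → m ℕ.≤ n
fromℕ-cancel-≤ {m} {n} le = subst₂ ℕ._≤_ (ℕP.*-identityʳ m) (ℕP.*-identityʳ n) (/-cancel-≤ {m} {n} {0} {0} le)

fromℕ-cancel-< : ∀ {m n} → fromℕ m < fromℕ n → m ℕ.< n
fromℕ-cancel-< {m} {n} lt = subst₂ ℕ._<_ (ℕP.*-identityʳ m) (ℕP.*-identityʳ n) (/-cancel-< {m} {n} {0} {0} lt)

fromℕ-homo-+ : ∀ m n → fromℕ (m ℕ.+ n) ≡ fromℕ m + fromℕ n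
fromℕ-homo-+ m n rewrite fromℕ≡mkℚ m | fromℕ≡mkℚ n =
  cong (ℚ._/ 1) (cong₂ ℤ._+_ (sym (ℤP.*-identityʳ (+ m))) (sym (ℤP.*-identityʳ (+ n))))

0≤fromℕ : ∀ n → 0ℚ ≤ fromℕ n
0≤fromℕ n = fromℕ-mono-≤ {0} {n} z≤n

fromℕ-double : ∀ n → fromℕ (2 ℕ.* n) ≡ fromℕ n + fromℕ n
fromℕ-double n = trans (fromℕ-homo-+ n (n ℕ.+ 0)) (cong (λ m → fromℕ n + fromℕ m) (ℕP.+-identityʳ n))

ceilℕ-mkℚ : ∀ n d .(c : Coprime n (suc d)) → ceilℕ (mkℚ (+ n) d c) ≡ ∣ ℤ.- ((ℤ.- + n) ℤ./ + suc d) ∣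
ceilℕ-mkℚ zero    d c = refl
ceilℕ-mkℚ (suc n) d c = refl

≤-ceilℕ : ∀ {p} → 0ℚ ≤ p → p ≤ fromℕ (ceilℕ p)
≤-ceilℕ {mkℚ -[1+ _ ] _ _} (*≤* ())
≤-ceilℕ {p@(mkℚ (+ n) d c)} _ rewrite ceilℕ-mkℚ n d c =
  subst (_≤ fromℕ k) (ℚP.↥p/↧p≡p p)
        (/-mono-≤ {n} {k} {d} {0} (subst (ℕ._≤ k ℕ.* suc d) (sym (ℕP.*-identityʳ n)) (proj₁ (ceilDiv-bounds n d))))
  where k = ∣ ℤ.- ((ℤ.- + n) ℤ./ + suc d) ∣

ceilℕ-pred-< : ∀ {p k} → 0ℚ ≤ p → ceilℕ p ≡ suc k → fromℕ k < p
ceilℕ-pred-< {mkℚ -[1+ _ ] _ _} (*≤* ())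
ceilℕ-pred-< {p@(mkℚ (+ n) d c)} {k} _ ceil≡1+k rewrite ceilℕ-mkℚ n d c =
  subst (fromℕ k <_) (ℚP.↥p/↧p≡p p) (/-mono-< {k} {n} {0} {d} (subst (k ℕ.* suc d ℕ.<_) (sym (ℕP.*-identityʳ n)) k*D<n))
  where
  k*D<n : k ℕ.* suc d ℕ.< n
  k*D<n = ℕP.+-cancelˡ-< (suc d) _ _
    (subst₂ ℕ._<_ (cong (ℕ._* suc d) ceil≡1+k) (ℕP.+-comm n (suc d)) (proj₂ (ceilDiv-bounds n d)))

½ : ℚ
½ = + 1 ℚ./ 2

0≤½ : 0ℚ ≤ ½
0≤½ = /-mono-≤ {0} {1} {0} {1} z≤n

p*½+p*½≡p : ∀ p → p * ½ + p * ½ ≡ p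
p*½+p*½≡p = solve 1 (λ p → p :* con ½ :+ p :* con ½ := p) refl
  where open +-*-Solver

≤-2*ceilℕ : ∀ {x} m → 0ℚ ≤ x → fromℕ m ≤ x + x → m ℕ.≤ 2 ℕ.* ceilℕ x
≤-2*ceilℕ {x} m 0≤x m≤2x = fromℕ-cancel-≤ (begin
  fromℕ m                           ≤⟨ m≤2x ⟩
  x + x                             ≤⟨ ℚP.+-mono-≤ (≤-ceilℕ 0≤x) (≤-ceilℕ 0≤x) ⟩
  fromℕ (ceilℕ x) + fromℕ (ceilℕ x) ≡⟨ sym (fromℕ-double (ceilℕ x)) ⟩
  fromℕ (2 ℕ.* ceilℕ x)             ∎)
  where open ℚP.≤-Reasoning

2*ceilℕ∸1≤ : ∀ {x} h → 0ℚ ≤ x → x + x ≤ fromℕ h → 2 ℕ.* ceilℕ x ∸ 1 ℕ.≤ h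
2*ceilℕ∸1≤ {x} h 0≤x 2x≤h with ceilℕ x in ceil≡
... | zero  = z≤n
... | suc k = subst (λ m → m ∸ 1 ℕ.≤ h) (sym (ℕP.*-suc 2 k)) (fromℕ-cancel-< (begin-strict
  fromℕ (2 ℕ.* k)   ≡⟨ fromℕ-double k ⟩
  fromℕ k + fromℕ k <⟨ ℚP.+-mono-< (ceilℕ-pred-< 0≤x ceil≡) (ceilℕ-pred-< 0≤x ceil≡) ⟩
  x + x             ≤⟨ 2x≤h ⟩
  fromℕ h           ∎))
  where open ℚP.≤-Reasoning

≤-2*aX : ∀ {δ} n h d → 0ℚ ≤ δ → n ≡ h ℕ.+ d → (1ℚ - δ) * fromℕ n ≤ fromℕ h → d ℕ.≤ 2 ℕ.* aX n δ
≤-2*aX {δ} n h d 0≤δ n≡h+d h-bound =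
  ≤-2*ceilℕ d (*-nonNeg (*-nonNeg 0≤δ (0≤fromℕ n)) 0≤½) (begin
    fromℕ d                       ≡⟨ solve 2 (λ h d → d := (h :+ d) :- h) refl (fromℕ h) (fromℕ d) ⟩
    (fromℕ h + fromℕ d) - fromℕ h ≡⟨ cong (_- fromℕ h) (trans (sym (fromℕ-homo-+ h d)) (cong fromℕ (sym n≡h+d))) ⟩
    N - fromℕ h                   ≤⟨ ℚP.+-monoʳ-≤ N (ℚP.neg-antimono-≤ h-bound) ⟩
    N - (1ℚ - δ) * N              ≡⟨ solve 2 (λ δ N → N :- (con 1ℚ :- δ) :* N := δ :* N) refl δ N ⟩
    δ * N                         ≡⟨ sym (p*½+p*½≡p (δ * N)) ⟩
    δ * N * ½ + δ * N * ½         ∎)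
  where
  N = fromℕ n
  open ℚP.≤-Reasoning
  open +-*-Solver

onesX : ℕ → ℚ → ℕ
onesX n δ = 2 ℕ.* ceilℕ ((1ℚ - δ) * fromℕ n * ½) ∸ 1

onesX≤ : ∀ {δ} n h → δ ≤ 1ℚ → (1ℚ - δ) * fromℕ n ≤ fromℕ h → onesX n δ ℕ.≤ h
onesX≤ {δ} n h δ≤1 h-bound =
  2*ceilℕ∸1≤ h (*-nonNeg (*-nonNeg (p≤q⇒0≤q-p δ≤1) (0≤fromℕ n)) 0≤½)
               (subst (_≤ fromℕ h) (sym (p*½+p*½≡p _)) h-bound)

0≤ratio : ∀ m → 0ℚ ≤ ratio m
0≤ratio zero    = 0≤1
0≤ratio (suc m) = /-mono-≤ {0} {m} {0} {m} z≤n

ratio≤1 : ∀ m → ratio m ≤ 1ℚ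
ratio≤1 zero    = ℚP.≤-refl
ratio≤1 (suc m) = /-mono-≤ {m} {1} {m} {0}
  (subst₂ ℕ._≤_ (sym (ℕP.*-identityʳ m)) (sym (ℕP.*-identityˡ (suc m))) (ℕP.n≤1+n m))

ratio-mono : ∀ {m n} → m ℕ.≤ n → ratio (suc m) ≤ ratio (suc n)
ratio-mono {m} {n} m≤n = /-mono-≤ {m} {n} {m} {n} (begin
  m ℕ.* suc n   ≡⟨ ℕP.*-suc m n ⟩
  m ℕ.+ m ℕ.* n ≤⟨ ℕP.+-mono-≤ m≤n (ℕP.≤-reflexive (ℕP.*-comm m n)) ⟩
  n ℕ.+ n ℕ.* m ≡⟨ sym (ℕP.*-suc n m) ⟩
  n ℕ.* suc m   ∎)
  where open ℕP.≤-Reasoning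

ratio≤piFactor : ∀ m → ratio m ≤ piFactor m
ratio≤piFactor zero          = ℚP.≤-refl
ratio≤piFactor (suc zero)    = ratio≤1 1
ratio≤piFactor (suc (suc m)) = ℚP.≤-refl

0≤piFactor : ∀ m → 0ℚ ≤ piFactor m
0≤piFactor m = ℚP.≤-trans (0≤ratio m) (ratio≤piFactor m)

-- piFrom s r is the π-product of the letters r (listed from the right) of a
-- word that stands to the left of a word of digit sum s; piFin x = piFrom 0 (reverse x).
piFrom : ℕ → List Digit → ℚ
piFrom s r = foldr (λ m q → piFactor m * q) 1ℚ (gFromRight s r)

piFrom-++ : ∀ s p q → piFrom s (p ++ q) ≡ piFrom s p * piFrom (s ℕ.+ dsum p) q
piFrom-++ s []        q rewrite ℕP.+-identityʳ s = sym (ℚP.*-identityˡ _)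
piFrom-++ s (one ∷ p) q rewrite piFrom-++ (s ℕ.+ 1) p q | ℕP.+-assoc s 1 (dsum p) = refl
piFrom-++ s (two ∷ p) q rewrite piFrom-++ (s ℕ.+ 2) p q | ℕP.+-assoc s 2 (dsum p) =
  sym (ℚP.*-assoc (piFactor (suc s)) _ _)

0≤piFrom : ∀ s r → 0ℚ ≤ piFrom s r
0≤piFrom s []        = 0≤1
0≤piFrom s (one ∷ r) = 0≤piFrom (s ℕ.+ 1) r
0≤piFrom s (two ∷ r) = *-nonNeg (0≤piFactor (suc s)) (0≤piFrom (s ℕ.+ 2) r)

ratioProduct : List ℕ → ℚ
ratioProduct = foldr (λ m q → ratio m * q) 1ℚ

0≤ratioProduct : ∀ ms → 0ℚ ≤ ratioProduct ms
0≤ratioProduct []       = 0≤1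
0≤ratioProduct (m ∷ ms) = *-nonNeg (0≤ratio m) (0≤ratioProduct ms)

ratioProduct≤1 : ∀ ms → ratioProduct ms ≤ 1ℚ
ratioProduct≤1 []       = ℚP.≤-refl
ratioProduct≤1 (m ∷ ms) = *-mono-≤-nonNeg (0≤ratio m) (0≤ratioProduct ms) (ratio≤1 m) (ratioProduct≤1 ms)

-- The i-th letter 2 of r sees digit sum ≥ s + 2(i-1) ≥ b + 2(i-1) to its right,
-- as the i-th letter 2 of 2^a does next to a word of digit sum b; r has at most
-- a letters 2, and the surplus factors on the left are ≤ 1.
ratioProduct-twos≤piFrom : ∀ r {s b} a → b ℕ.≤ s → dsum r ℕ.≤ 2 ℕ.* a →
                           ratioProduct (gFromRight b (replicate a two)) ≤ piFrom s r
ratioProduct-twos≤piFrom []        {b = b} a _ _ = ratioProduct≤1 (gFromRight b (replicate a two))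
ratioProduct-twos≤piFrom (one ∷ r) a       b≤s |r|≤2a =
  ratioProduct-twos≤piFrom r a (ℕP.≤-trans b≤s (ℕP.m≤m+n _ 1)) (ℕP.≤-trans (ℕP.n≤1+n _) |r|≤2a)
ratioProduct-twos≤piFrom (two ∷ r) zero    _   ()
ratioProduct-twos≤piFrom (two ∷ r) {s} {b} (suc a) b≤s |r|≤2a =
  *-mono-≤-nonNeg (0≤ratio (suc b)) (0≤ratioProduct (gFromRight (b ℕ.+ 2) (replicate a two)))
    (ℚP.≤-trans (ratio-mono b≤s) (ratio≤piFactor (suc s)))
    (ratioProduct-twos≤piFrom r a (ℕP.+-monoˡ-≤ 2 b≤s)
      (ℕP.+-cancelˡ-≤ 2 _ _ (subst (2 ℕ.+ dsum r ℕ.≤_) (ℕP.*-suc 2 a) |r|≤2a)))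

prodFrom1-cong : ∀ a {f f′ : ℕ → ℚ} → (∀ i → f (suc i) ≡ f′ (suc i)) → prodFrom1 a f ≡ prodFrom1 a f′
prodFrom1-cong zero    f≗f′ = refl
prodFrom1-cong (suc a) f≗f′ = cong₂ _*_ (prodFrom1-cong a f≗f′) (f≗f′ a)

prodFrom1-suc : ∀ a (f : ℕ → ℚ) → prodFrom1 (suc a) f ≡ f 1 * prodFrom1 a (f ∘ suc)
prodFrom1-suc zero    f = trans (ℚP.*-identityˡ (f 1)) (sym (ℚP.*-identityʳ (f 1)))
prodFrom1-suc (suc a) f = trans (cong (_* f (suc (suc a))) (prodFrom1-suc a f)) (ℚP.*-assoc (f 1) _ _)

prodFrom1-nth : ∀ ms → prodFrom1 (length ms) (λ i → ratio (nth ms (i ∸ 1))) ≡ ratioProduct ms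
prodFrom1-nth []       = refl
prodFrom1-nth (m ∷ ms) = trans (prodFrom1-suc (length ms) _)
  (cong (ratio m *_) (trans (prodFrom1-cong (length ms) λ _ → refl) (prodFrom1-nth ms)))

length-gFromRight-twos : ∀ s a → length (gFromRight s (replicate a two)) ≡ a
length-gFromRight-twos s zero    = refl
length-gFromRight-twos s (suc a) = cong suc (length-gFromRight-twos (s ℕ.+ 2) a)

gFromRight-ones : ∀ s b r → gFromRight s (replicate b one ++ r) ≡ gFromRight (s ℕ.+ b) r
gFromRight-ones s zero    r rewrite ℕP.+-identityʳ s = refl
gFromRight-ones s (suc b) r rewrite gFromRight-ones (s ℕ.+ 1) b r | ℕP.+-assoc s 1 b = refl

replicate-∷ʳ : ∀ {A : Set} n (x : A) → replicate n x ++ [ x ] ≡ x ∷ replicate n x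
replicate-∷ʳ zero    x = refl
replicate-∷ʳ (suc n) x = cong (x ∷_) (replicate-∷ʳ n x)

reverse-replicate : ∀ {A : Set} n (x : A) → reverse (replicate n x) ≡ replicate n x
reverse-replicate zero    x = refl
reverse-replicate (suc n) x = begin
  reverse (x ∷ replicate n x)       ≡⟨ ListP.unfold-reverse x (replicate n x) ⟩
  reverse (replicate n x) ++ [ x ]  ≡⟨ cong (_++ [ x ]) (reverse-replicate n x) ⟩
  replicate n x ++ [ x ]            ≡⟨ replicate-∷ʳ n x ⟩
  x ∷ replicate n x                 ∎
  where open ≡-Reasoning

gList-twos-ones : ∀ a b → gList (replicate a two ++ replicate b one) ≡ gFromRight b (replicate a two)
gList-twos-ones a b
  rewrite ListP.reverse-++ (replicate a two) (replicate b one)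
        | reverse-replicate b one | reverse-replicate a two = gFromRight-ones 0 b (replicate a two)

prodFrom1-ratio-g-twos-ones : ∀ a b →
  prodFrom1 a (λ i → ratio (g (replicate a two ++ replicate b one) i)) ≡ ratioProduct (gFromRight b (replicate a two))
prodFrom1-ratio-g-twos-ones a b = begin
  prodFrom1 a (λ i → ratio (nth (gList (replicate a two ++ replicate b one)) (i ∸ 1)))
    ≡⟨ cong (λ ms → prodFrom1 a (λ i → ratio (nth ms (i ∸ 1)))) (gList-twos-ones a b) ⟩
  prodFrom1 a (λ i → ratio (nth ms (i ∸ 1)))
    ≡⟨ cong (λ l → prodFrom1 l (λ i → ratio (nth ms (i ∸ 1)))) (sym (length-gFromRight-twos b a)) ⟩
  prodFrom1 (length ms) (λ i → ratio (nth ms (i ∸ 1)))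
    ≡⟨ prodFrom1-nth ms ⟩
  ratioProduct ms ∎
  where
  ms = gFromRight b (replicate a two)
  open ≡-Reasoning

dsum-++ : ∀ p q → dsum (p ++ q) ≡ dsum p ℕ.+ dsum q
dsum-++ []      q = refl
dsum-++ (d ∷ p) q = trans (cong (val d ℕ.+_) (dsum-++ p q)) (sym (ℕP.+-assoc (val d) (dsum p) (dsum q)))

dsum≡sum∘map : ∀ x → dsum x ≡ sum (map val x)
dsum≡sum∘map []      = refl
dsum≡sum∘map (d ∷ x) = cong (val d ℕ.+_) (dsum≡sum∘map x)

dsum-reverse : ∀ x → dsum (reverse x) ≡ dsum x
dsum-reverse x = begin
  dsum (reverse x)           ≡⟨ dsum≡sum∘map (reverse x) ⟩
  sum (map val (reverse x))  ≡⟨ sum-↭ (map⁺ val (↭-reverse x)) ⟩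
  sum (map val x)            ≡⟨ sym (dsum≡sum∘map x) ⟩
  dsum x                     ∎
  where open ≡-Reasoning

letters : ℕ → InfWord → List Digit
letters zero    w = []
letters (suc k) w = w 0 ∷ letters k (w ∘ suc)

reverse-suffix : ∀ k w → reverse (suffix k w) ≡ letters k w
reverse-suffix zero    w = refl
reverse-suffix (suc k) w rewrite ListP.reverse-++ (suffix k (w ∘ suc)) [ w 0 ] =
  cong (w 0 ∷_) (reverse-suffix k (w ∘ suc))

CommonPrefixSplit : List Digit → InfWord → ℕ → Set
CommonPrefixSplit r w h = Σ ℕ λ k → Σ (List Digit) λ q → (r ≡ letters k w ++ q) × (h ≡ dsum (letters k w))

commonPrefixSplit-∷ : ∀ {d r w} → w 0 ≡ d → CommonPrefixSplit r (w ∘ suc) (hcsRev r (w ∘ suc)) →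
                      CommonPrefixSplit (d ∷ r) w (val d ℕ.+ hcsRev r (w ∘ suc))
commonPrefixSplit-∷ refl (k , q , r≡ , h≡) = suc k , q , cong (_ ∷_) r≡ , cong (val _ ℕ.+_) h≡

hcsRev-split : ∀ r w → CommonPrefixSplit r w (hcsRev r w)
hcsRev-split []        w = 0 , [] , refl , refl
hcsRev-split (one ∷ r) w with w 0 in w0≡
... | one = commonPrefixSplit-∷ w0≡ (hcsRev-split r (w ∘ suc))
... | two = 0 , one ∷ r , refl , refl
hcsRev-split (two ∷ r) w with w 0 in w0≡
... | one = 0 , two ∷ r , refl , refl
... | two = commonPrefixSplit-∷ w0≡ (hcsRev-split r (w ∘ suc))

piFin-split : ∀ v w → Σ ℕ λ k → Σ (List Digit) λ q →
              (dsum v ≡ h' v w ℕ.+ dsum q) × (piFin v ≡ piPartial w k * piFrom (h' v w) q)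
piFin-split v w with hcsRev-split (reverse v) w
... | k , q , v≡ , h'≡ = k , q , dsum-split , piFin-factorises
  where
  open ≡-Reasoning
  dsum-split : dsum v ≡ h' v w ℕ.+ dsum q
  dsum-split = begin
    dsum v                            ≡⟨ sym (dsum-reverse v) ⟩
    dsum (reverse v)                  ≡⟨ cong dsum v≡ ⟩
    dsum (letters k w ++ q)           ≡⟨ dsum-++ (letters k w) q ⟩
    dsum (letters k w) ℕ.+ dsum q     ≡⟨ cong (ℕ._+ dsum q) (sym h'≡) ⟩
    h' v w ℕ.+ dsum q                 ∎
  piFin-factorises : piFin v ≡ piPartial w k * piFrom (h' v w) q
  piFin-factorises = begin
    piFrom 0 (reverse v)                                      ≡⟨ cong (piFrom 0) v≡ ⟩
    piFrom 0 (letters k w ++ q)                               ≡⟨ piFrom-++ 0 (letters k w) q ⟩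
    piFrom 0 (letters k w) * piFrom (dsum (letters k w)) q    ≡⟨ cong₂ (λ p s → piFrom 0 p * piFrom s q) (sym (reverse-suffix k w)) (sym h'≡) ⟩
    piFrom 0 (reverse (suffix k w)) * piFrom (h' v w) q       ∎

mainTheorem16 : (w : InfWord) → InYFInfPlus w → (δ : ℚ) → 0ℚ < δ → δ < 1ℚ
    → (n : ℕ) → n ≥ 1 → (v : Word) → InP w n δ v
    → (ε : ℚ) → 0ℚ < ε
    → Σ ℕ (λ k → prodFrom1 (aX n δ) (λ i → ratio (g (wordX n δ) i)) * piPartial w k ≤ piFin v + ε)
mainTheorem16 w _ δ 0<δ δ<1 n _ v (|v|≡n , h'-bound) ε 0<ε with piFin-split v w
... | k , q , |v|≡h+|q| , piFin≡ = k , (begin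
  prodFrom1 a (λ i → ratio (g (wordX n δ) i)) * πw  ≡⟨ cong (_* πw) (prodFrom1-ratio-g-twos-ones a b) ⟩
  ratioProduct (gFromRight b (replicate a two)) * πw ≤⟨ ℚP.*-monoʳ-≤-nonNeg πw {{ℚ.nonNegative 0≤πw}} X≤q ⟩
  piFrom h q * πw                                    ≡⟨ trans (ℚP.*-comm _ πw) (sym piFin≡) ⟩
  piFin v                                            ≡⟨ sym (ℚP.+-identityʳ (piFin v)) ⟩
  piFin v + 0ℚ                                       ≤⟨ ℚP.+-monoʳ-≤ (piFin v) (ℚP.<⇒≤ 0<ε) ⟩
  piFin v + ε                                        ∎)
  where
  open ℚP.≤-Reasoning
  a = aX n δ
  b = onesX n δ
  h = h' v w
  πw = piPartial w k
  0≤πw : 0ℚ ≤ πw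
  0≤πw = 0≤piFrom 0 (reverse (suffix k w))
  X≤q : ratioProduct (gFromRight b (replicate a two)) ≤ piFrom h q
  X≤q = ratioProduct-twos≤piFrom q a (onesX≤ n h (ℚP.<⇒≤ δ<1) h'-bound)
          (≤-2*aX n h (dsum q) (ℚP.<⇒≤ 0<δ) (trans (sym |v|≡n) |v|≡h+|q|) h'-bound)
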